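{- Let $G$ be drawn from the graph model and let $G_{\mathrm{pre}}$ be any graph yielding $G$ with nonzero probability under the adversary. Then the good nodes are precisely the nodes that have the goodness property with respect to $G$.
   Context: A node has the goodness property with respect to a graph if at least three of its neighbours in that graph do not have degree 2. Graph model with constants $a>b>0$, $\varepsilon=\frac{b}{a+b}$, $\delta=1$ if $\varepsilon\le\frac13$ and $\delta=(1-2\varepsilon)^2/\varepsilon^2$ otherwise: spins $\sigma_v\in\{\pm1\}$ i.i.d.\ uniform on $n$ vertices; precursor $G_{\mathrm{pre}}$ has each pair as an edge independently with probability $a/n$ (equal spins) or $b/n$ (opposite spins). The adversary: mark $v$ "good" if it has the goodness property with respect to $G_{\mathrm{pre}}$; mark a vertex of degree 2 in $G_{\mathrm{pre}}$ "marked" if both its neighbours are good; for each marked $v$ whose two neighbours both have spin opposite to $v$, independently with probability $\delta$ delete both edges incident to $v$. The result is $G$; markings refer to $G_{\mathrm{pre}}$.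
   Formalization: The constants a and b of the graph model are rational numbers. -}

module Defs where

open import Data.Bool using (Bool; true; false; _∧_; not; T)
open import Data.Bool.Properties using (∧-comm)
open import Data.Nat using (ℕ; _≤_; _≡ᵇ_)
open import Data.Fin using (Fin)
open import Data.List using (length; filterᵇ; allFin)
open import Data.Product using (_×_)
open import Relation.Binary.PropositionalEquality using (_≡_; _≢_; refl; cong₂; trans)

record Graph (n : ℕ) : Set where
  field
    adj    : Fin n → Fin n → Bool
    sym    : ∀ u v → adj u v ≡ adj v u
    irrefl : ∀ v → adj v v ≡ false
open Graph public

-- Spins σ_v ∈ {±1}, encoded as Bool (true = +1, false = -1).
Spins : ℕ → Set
Spins n = Fin n → Bool

count : ∀ {n} → (Fin n → Bool) → ℕ
count {n} p = length (filterᵇ p (allFin n))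

degree : ∀ {n} → Graph n → Fin n → ℕ
degree G v = count (adj G v)

nbrNotDeg2 : ∀ {n} → Graph n → Fin n → Fin n → Bool
nbrNotDeg2 G v w = adj G v w ∧ not (degree G w ≡ᵇ 2)

HasGoodness : ∀ {n} → Graph n → Fin n → Set
HasGoodness G v = 3 ≤ count (nbrNotDeg2 G v)

Good : ∀ {n} → Graph n → Fin n → Set
Good Gpre v = HasGoodness Gpre v

Marked : ∀ {n} → Graph n → Fin n → Set
Marked Gpre v = (degree Gpre v ≡ 2) × (∀ w → adj Gpre v w ≡ true → Good Gpre w)

-- marked vertex whose (two) neighbours both have spin opposite to v:
-- these are the vertices the adversary may isolate (with probability δ each)
Deletable : ∀ {n} → Spins n → Graph n → Fin n → Set
Deletable σ Gpre v = Marked Gpre v × (∀ w → adj Gpre v w ≡ true → σ w ≢ σ v)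

-- Result of deleting both edges incident to each vertex in D
-- (D v ≡ true means the adversary's coin for v came up "delete").
deleteAt : ∀ {n} → Graph n → (Fin n → Bool) → Graph n
deleteAt {n} Gpre D = record { adj = A ; sym = s ; irrefl = i }
  where
  A : Fin n → Fin n → Bool
  A u v = adj Gpre u v ∧ (not (D u) ∧ not (D v))
  s : ∀ u v → A u v ≡ A v u
  s u v = cong₂ _∧_ (sym Gpre u v) (∧-comm (not (D u)) (not (D v)))
  i : ∀ v → A v v ≡ false
  i v rewrite irrefl Gpre v = refl

-- A deleted vertex has degree 2 in G_pre, so it is not good, and it is isolated in G, so it
-- lacks the goodness property there too. For a kept vertex w, whether deg w = 2 is the same
-- in G_pre and G: if w is good, its three non-degree-2 neighbours survive (deleted vertices
-- have degree 2), so deg w ≥ 3 in both graphs; if w is not good, it has no deleted neighbour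
-- (neighbours of deleted vertices are good), so its neighbourhood is unchanged. Hence a kept
-- vertex has the same non-degree-2 neighbours in both graphs.
module Submission where

open import Defs hiding (sym)
open import Data.Bool using (Bool; true; false; _∧_; not; T; T?; _≟_)
open import Data.Bool.Properties using (∧-zeroʳ; ∧-identityʳ; ¬-not)
open import Data.Empty using (⊥-elim)
open import Data.Fin using (Fin)
open import Data.List using (length; allFin)
open import Data.List.Properties using (filter-none)
open import Data.List.Relation.Unary.All using (universal)
open import Data.List.Relation.Binary.Sublist.Propositional using (⊆-refl)
open import Data.List.Relation.Binary.Sublist.Propositional.Properties using (filter⁺; length-mono-≤)
open import Data.Nat using (ℕ; _≡ᵇ_; s≤s) renaming (_≤_ to _≤ℕ_)
open import Data.Nat.Properties using (≤-trans; ≤-antisym; _≤?_)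
open import Data.Product using (proj₁; proj₂)
open import Data.Rational using (ℚ; 0ℚ; _<_; _≤_; _+_)
open import Function using (_∘_)
open import Function.Bundles using (_⇔_; mk⇔)
open import Relation.Nullary using (¬_; yes; no)
open import Relation.Binary.PropositionalEquality
  using (_≡_; refl; sym; trans; cong; cong₂; subst)

module _ {n : ℕ} where

  count-mono : {p q : Fin n → Bool} → (∀ x → T (p x) → T (q x)) → count p ≤ℕ count q
  count-mono {p} {q} p⇒q =
    length-mono-≤ (filter⁺ (T? ∘ p) (T? ∘ q) (λ { refl → p⇒q _ }) (⊆-refl {x = allFin n}))

  count-cong : {p q : Fin n → Bool} → (∀ x → p x ≡ q x) → count p ≡ count q
  count-cong p≗q = ≤-antisym (count-mono (λ x → subst T (p≗q x)))
                             (count-mono (λ x → subst T (sym (p≗q x))))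

  count-none : {p : Fin n → Bool} → (∀ x → p x ≡ false) → count p ≡ 0
  count-none {p} none =
    cong length (filter-none (T? ∘ p) (universal (λ x px → subst T (none x) px) (allFin n)))

T-∧ˡ : ∀ {a b} → T (a ∧ b) → T a
T-∧ˡ {true} _ = _

3≤⇒≢ᵇ2 : ∀ {d} → 3 ≤ℕ d → (d ≡ᵇ 2) ≡ false
3≤⇒≢ᵇ2 (s≤s (s≤s (s≤s _))) = refl

module _ {n : ℕ} (G : Graph n) where

  count-nbrNotDeg2≤degree : ∀ v → count (nbrNotDeg2 G v) ≤ℕ degree G v
  count-nbrNotDeg2≤degree v = count-mono {p = nbrNotDeg2 G v} {q = adj G v} (λ _ → T-∧ˡ)

  HasGoodness⇒3≤degree : ∀ {v} → HasGoodness G v → 3 ≤ℕ degree G v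
  HasGoodness⇒3≤degree {v} g = ≤-trans g (count-nbrNotDeg2≤degree v)

  degree≡2⇒¬HasGoodness : ∀ {v} → degree G v ≡ 2 → ¬ HasGoodness G v
  degree≡2⇒¬HasGoodness deg≡2 g with subst (3 ≤ℕ_) deg≡2 (HasGoodness⇒3≤degree g)
  ... | s≤s (s≤s ())

  isolated⇒¬HasGoodness : ∀ {v} → (∀ w → adj G v w ≡ false) → ¬ HasGoodness G v
  isolated⇒¬HasGoodness {v} isolated g with subst (3 ≤ℕ_) (count-none none) g
    where
    none : ∀ w → nbrNotDeg2 G v w ≡ false
    none w rewrite isolated w = refl
  ... | ()

module _ {n : ℕ} (G : Graph n) (D : Fin n → Bool) where

  deleteAt-adj-deleted : ∀ {v} → D v ≡ true → ∀ w → adj (deleteAt G D) v w ≡ false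
  deleteAt-adj-deleted {v} Dv w rewrite Dv = ∧-zeroʳ (adj G v w)

  deleteAt-adj-kept : ∀ {v w} → D v ≡ false → D w ≡ false → adj (deleteAt G D) v w ≡ adj G v w
  deleteAt-adj-kept {v} {w} Dv Dw rewrite Dv | Dw = ∧-identityʳ (adj G v w)

module _ {n : ℕ} (G : Graph n) (D : Fin n → Bool)
         (deleted⇒marked : ∀ v → D v ≡ true → Marked G v) where

  private
    H : Graph n
    H = deleteAt G D

  deleted⇒degree≡2 : ∀ {v} → D v ≡ true → degree G v ≡ 2
  deleted⇒degree≡2 Dv = proj₁ (deleted⇒marked _ Dv)

  deleted⇒¬nbrNotDeg2 : ∀ {v w} → D w ≡ true → nbrNotDeg2 G v w ≡ false
  deleted⇒¬nbrNotDeg2 {v} {w} Dw rewrite deleted⇒degree≡2 Dw = ∧-zeroʳ (adj G v w)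

  nbrNotDeg2⇒kept : ∀ {v w} → T (nbrNotDeg2 G v w) → D w ≡ false
  nbrNotDeg2⇒kept {v} {w} t with D w in Dw
  ... | false = refl
  ... | true  = ⊥-elim (subst T (deleted⇒¬nbrNotDeg2 Dw) t)

  good⇒3≤degree-deleteAt : ∀ {w} → D w ≡ false → Good G w → 3 ≤ℕ degree H w
  good⇒3≤degree-deleteAt {w} Dw g = ≤-trans g (count-mono survives)
    where
    survives : ∀ x → T (nbrNotDeg2 G w x) → T (adj H w x)
    survives x t rewrite deleteAt-adj-kept G D Dw (nbrNotDeg2⇒kept t) = T-∧ˡ t

  notGood⇒adj-deleteAt : ∀ {w} → D w ≡ false → ¬ Good G w → ∀ x → adj H w x ≡ adj G w x
  notGood⇒adj-deleteAt {w} Dw ¬g x with adj G w x in wx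
  ... | false = refl
  ... | true rewrite Dw with D x in Dx
  ...   | false = refl
  ...   | true = ⊥-elim (¬g (proj₂ (deleted⇒marked x Dx) w (trans (Graph.sym G x w) wx)))

  kept⇒degree≡ᵇ2-deleteAt : ∀ {w} → D w ≡ false → (degree H w ≡ᵇ 2) ≡ (degree G w ≡ᵇ 2)
  kept⇒degree≡ᵇ2-deleteAt {w} Dw with 3 ≤? count (nbrNotDeg2 G w)
  ... | yes g  = trans (3≤⇒≢ᵇ2 (good⇒3≤degree-deleteAt Dw g))
                       (sym (3≤⇒≢ᵇ2 (HasGoodness⇒3≤degree G g)))
  ... | no ¬g = cong (_≡ᵇ 2) (count-cong (notGood⇒adj-deleteAt Dw ¬g))

  kept⇒nbrNotDeg2-deleteAt : ∀ {v} → D v ≡ false → ∀ x → nbrNotDeg2 H v x ≡ nbrNotDeg2 G v x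
  kept⇒nbrNotDeg2-deleteAt {v} Dv x with D x ≟ true
  ... | no Dx≢true = cong₂ _∧_ (deleteAt-adj-kept G D Dv Dx)
                               (cong not (kept⇒degree≡ᵇ2-deleteAt Dx))
    where Dx = ¬-not Dx≢true
  ... | yes Dx = trans (cong (_∧ _) (trans (Graph.sym H v x) (deleteAt-adj-deleted G D Dx v)))
                       (sym (deleted⇒¬nbrNotDeg2 Dx))

  Good⇔HasGoodness-deleteAt : ∀ v → Good G v ⇔ HasGoodness H v
  Good⇔HasGoodness-deleteAt v with D v ≟ true
  ... | yes Dv = mk⇔ (⊥-elim ∘ degree≡2⇒¬HasGoodness G (deleted⇒degree≡2 Dv))
                     (⊥-elim ∘ isolated⇒¬HasGoodness H (deleteAt-adj-deleted G D Dv))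
  ... | no Dv≢true = mk⇔ (subst (3 ≤ℕ_) (sym count-eq)) (subst (3 ≤ℕ_) count-eq)
    where
    count-eq : count (nbrNotDeg2 H v) ≡ count (nbrNotDeg2 G v)
    count-eq = count-cong (kept⇒nbrNotDeg2-deleteAt (¬-not Dv≢true))

lemma5p5 : (a b : ℚ) → 0ℚ < b → b < a →
    (n : ℕ) (σ : Spins n) (Gpre : Graph n) (D : Fin n → Bool) →
    (∀ v → D v ≡ true → Deletable σ Gpre v) →
    ((b + b + b) ≤ (a + b) → ∀ v → Deletable σ Gpre v → D v ≡ true) →
    ∀ v → Good Gpre v ⇔ HasGoodness (deleteAt Gpre D) v
lemma5p5 _ _ _ _ _ _ Gpre D deleted⇒deletable _ =
  Good⇔HasGoodness-deleteAt Gpre D (λ v → proj₁ ∘ deleted⇒deletable v)
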